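{- Let $\{V_j\}_{j\ge1}$ be a sequence of positive integers with $V_j=V_{j-1}+V_{j-2}$ for $j\ge3$, let $n\ge1$, let $d\ge2$ be even and $k>1$. Suppose $\lambda_1,\ldots,\lambda_k=\textsc{Greedy}(1,F_{2d}/F_d,\ldots,F_{kd}/F_d;F_{(k+1)d}/F_d)$. (i) $\lambda_i=L_d-1$ for $i\in\{1,k\}$ and $\lambda_i=L_d-2$ for $2\le i\le k-1$. (ii) $\textsc{Greedy}(1,F_{2d}/F_d,\ldots,F_{kd}/F_d;F_{(k+1)d}/F_d-1)=\lambda_1-1,\lambda_2,\ldots,\lambda_k$. (iii) $s\left(F_{(k+1)d}/F_d-1\right)=V_{n+(k+1)d}-V_{n+d}+V_n$.
   Context: $F_j,L_j$ are Fibonacci and Lucas numbers ($F_0=0,F_1=1,L_0=2,L_1=1$, $X_j=X_{j-1}+X_{j-2}$); $F_d\mid F_{jd}$. For positive integers $c_1,\ldots,c_k,C$, $\textsc{Greedy}(c_1,\ldots,c_k;C)=x_1^\star,\ldots,x_k^\star$ with $x_k^\star=\lfloor C/c_k\rfloor$ and $x_j^\star=\left\lfloor(C-\sum_{i>j}c_ix_i^\star)/c_j\right\rfloor$ for $j=k-1,\ldots,1$. For a positive integer $x$, let $K\ge1$ satisfy $F_{Kd}/F_d\le x<F_{(K+1)d}/F_d$, let $\mu_1,\ldots,\mu_K=\textsc{Greedy}(1,F_{2d}/F_d,\ldots,F_{Kd}/F_d;x)$, and set $s(x)=\sum_{i=1}^K\mu_iV_{n+id}$. -}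

module Defs where

open import Data.Nat using (ℕ; zero; suc; _+_; _*_; _∸_; _/_)

F : ℕ → ℕ
F zero = 0
F (suc zero) = 1
F (suc (suc j)) = F (suc j) + F j

L : ℕ → ℕ
L zero = 2
L (suc zero) = 1
L (suc (suc j)) = L (suc j) + L j

-- floor division; only ever applied to positive divisors in the statement
-- (value 0 for divisor 0 is an irrelevant convention)
fdiv : ℕ → ℕ → ℕ
fdiv C zero = 0
fdiv C (suc c) = C / suc c

-- Greedy(c_1,...,c_k; C), coefficients given as a function c indexed from 1.
-- residual c k C m = C - Σ_{i > k-m} c_i x_i*  (after fixing x_k*,...,x_{k-m+1}*)
residual : (ℕ → ℕ) → ℕ → ℕ → ℕ → ℕ
residual c k C zero = C
residual c k C (suc m) =
  residual c k C m ∸ c (k ∸ m) * fdiv (residual c k C m) (c (k ∸ m))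

-- Greedy c k C j = x_j*  (meaningful for 1 ≤ j ≤ k):
-- x_j* = ⌊(C - Σ_{i>j} c_i x_i*) / c_j⌋
Greedy : (ℕ → ℕ) → ℕ → ℕ → ℕ → ℕ
Greedy c k C j = fdiv (residual c k C (k ∸ j)) (c j)

coef : ℕ → ℕ → ℕ
coef d i = fdiv (F (i * d)) (F d)

sum1 : ℕ → (ℕ → ℕ) → ℕ
sum1 zero f = 0
sum1 (suc K) f = sum1 K f + f (suc K)

-- s(x) computed with a given K (the paper's K is the unique K ≥ 1 with
-- coef d K ≤ x < coef d (K+1)):
-- s(x) = Σ_{i=1}^K μ_i V_{n+id}, μ = Greedy(coef d 1, …, coef d K; x)
sK : (ℕ → ℕ) → ℕ → ℕ → ℕ → ℕ → ℕ
sK V n d K x = sum1 K (λ i → Greedy (coef d) K x i * V (n + i * d))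

-- For even d the Lucas identity W_{m+2d} + W_m = L_d W_{m+d}, valid for every Fibonacci-like W, shows
-- that both c_i = F_{id}/F_d and Y_i = V_{n+id} satisfy X_{i+2} + X_i = (2 + t) X_{i+1} with t = L_d − 2.
-- Writing Δ_j = c_{j+1} − c_j, one has c_{k+1} − ε = (1 + t) c_k + (Δ_{k−1} − ε) and
-- Δ_j − ε = t c_j + (Δ_{j−1} − ε) with every remainder below the next coefficient, so the greedy digits
-- for c_{k+1} − ε (ε ∈ {0, 1}) are 1 + t at the top, t in the middle and 1 + t − ε at the bottom.
-- For ε = 1 the sum Σ μ_i Y_i is t Σ Y_i + Y_k, which telescopes to Y_{k+1} + Y_0 − Y_1.
module Submission where

open import Data.Nat
  using (ℕ; zero; suc; _+_; _*_; _∸_; _/_; _≤_; _<_; z≤n; s≤s; z<s; _≤‴_; ≤‴-refl; ≤‴-step)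
open import Data.Nat.Divisibility using (_∣_; divides; n∣m*n)
open import Data.Nat.DivMod using (+-distrib-/-∣ˡ; m*n/n≡m; m<n⇒m/n≡0; n/1≡n)
open import Data.Nat.Properties
open import Algebra.Properties.CommutativeSemigroup +-commutativeSemigroup using (xy∙z≈xz∙y)
open import Data.Nat.Tactic.RingSolver using (solve-∀)
open import Data.Product using (_×_; _,_; proj₁; proj₂)
open import Data.Sum using (inj₁; inj₂)
open import Relation.Binary.PropositionalEquality

open import Defs

open ≡-Reasoning

FibonacciLike : (ℕ → ℕ) → Set
FibonacciLike W = ∀ j → W (2 + j) ≡ W (1 + j) + W j

evenIndicator : ℕ → ℕ
evenIndicator zero = 1
evenIndicator (suc zero) = 0
evenIndicator (suc (suc n)) = evenIndicator n

+-double-suc : ∀ d → suc d + suc d ≡ 2 + (d + d)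
+-double-suc d = cong suc (+-suc d d)

-- L_d W_{m+d} = W_{m+2d} + (-1)^d W_m at m = 0, with the sign moved to the side where it is positive.
LucasIdentity : ℕ → (ℕ → ℕ) → Set
LucasIdentity d W = W (d + d) + evenIndicator d * W 0 ≡ L d * W d + evenIndicator (suc d) * W 0

lucasIdentity-step : ∀ d W → FibonacciLike W →
  LucasIdentity (suc d) (λ j → W (1 + j)) → LucasIdentity d (λ j → W (2 + j)) →
  LucasIdentity (2 + d) W
lucasIdentity-step d W r ih-suc ih = +-cancelʳ-≡ _ _ _ (begin
    W (2 + d + (2 + d)) + e * W 0 + (e + o) * W 1
  ≡⟨ cong (λ x → x + e * W 0 + (e + o) * W 1) (trans (cong W index) (r (2 + (d + d)))) ⟩
    W (3 + (d + d)) + W (2 + (d + d)) + e * W 0 + (e + o) * W 1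
  ≡⟨ regroupˡ (W (3 + (d + d))) (W (2 + (d + d))) (W 1) (W 0) e o ⟩
    (W (3 + (d + d)) + o * W 1) + (W (2 + (d + d)) + e * (W 1 + W 0))
  ≡⟨ cong (λ w → (W (3 + (d + d)) + o * W 1) + (W (2 + (d + d)) + e * w)) (sym (r 0)) ⟩
    (W (3 + (d + d)) + o * W 1) + (W (2 + (d + d)) + e * W 2)
  ≡⟨ cong₂ _+_ ih-suc′ ih ⟩
    (L (suc d) * X + e * W 1) + (L d * X + o * W 2)
  ≡⟨ cong (λ w → (L (suc d) * X + e * W 1) + (L d * X + o * w)) (r 0) ⟩
    (L (suc d) * X + e * W 1) + (L d * X + o * (W 1 + W 0))
  ≡⟨ regroupʳ (L (suc d)) (L d) X (W 1) (W 0) e o ⟩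
    (L (suc d) + L d) * X + o * W 0 + (e + o) * W 1
  ∎)
  where
    e = evenIndicator d
    o = evenIndicator (suc d)
    X = W (2 + d)
    index : 2 + d + (2 + d) ≡ 4 + (d + d)
    index = trans (+-double-suc (suc d)) (cong (2 +_) (+-double-suc d))
    ih-suc′ : W (3 + (d + d)) + o * W 1 ≡ L (suc d) * X + e * W 1
    ih-suc′ = trans (cong (λ i → W (suc i) + o * W 1) (sym (+-double-suc d))) ih-suc
    regroupˡ : ∀ b a w₁ w₀ e o →
      b + a + e * w₀ + (e + o) * w₁ ≡ (b + o * w₁) + (a + e * (w₁ + w₀))
    regroupˡ = solve-∀
    regroupʳ : ∀ l₁ l₀ x w₁ w₀ e o →
      (l₁ * x + e * w₁) + (l₀ * x + o * (w₁ + w₀)) ≡ (l₁ + l₀) * x + o * w₀ + (e + o) * w₁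
    regroupʳ = solve-∀

lucasIdentity : ∀ d W → FibonacciLike W → LucasIdentity d W
lucasIdentity zero W r = lemma (W 0)
  where lemma : ∀ a → a + 1 * a ≡ 2 * a + 0 * a
        lemma = solve-∀
lucasIdentity (suc zero) W r = trans (cong (_+ 0) (r 0)) (lemma (W 1) (W 0))
  where lemma : ∀ b a → b + a + 0 ≡ 1 * b + 1 * a
        lemma = solve-∀
lucasIdentity (suc (suc d)) W r =
  lucasIdentity-step d W r (lucasIdentity (suc d) (λ j → W (1 + j)) (λ j → r (1 + j)))
                         (lucasIdentity d (λ j → W (2 + j)) (λ j → r (2 + j)))

evenIndicator-even : ∀ q → evenIndicator (q * 2) ≡ 1
evenIndicator-even zero = refl
evenIndicator-even (suc q) = evenIndicator-even q

evenIndicator-odd : ∀ q → evenIndicator (suc (q * 2)) ≡ 0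
evenIndicator-odd zero = refl
evenIndicator-odd (suc q) = evenIndicator-odd q

lucasIdentity-even : ∀ {d} W → FibonacciLike W → 2 ∣ d → W (d + d) + W 0 ≡ L d * W d
lucasIdentity-even {d} W r (divides q refl) = begin
  W (d + d) + W 0                          ≡⟨ cong (W (d + d) +_) (sym (*-identityˡ (W 0))) ⟩
  W (d + d) + 1 * W 0                      ≡⟨ cong (λ e → W (d + d) + e * W 0) (sym (evenIndicator-even q)) ⟩
  W (d + d) + evenIndicator d * W 0        ≡⟨ lucasIdentity d W r ⟩
  L d * W d + evenIndicator (suc d) * W 0  ≡⟨ cong (λ e → L d * W d + e * W 0) (evenIndicator-odd q) ⟩
  L d * W d + 0                            ≡⟨ +-identityʳ (L d * W d) ⟩
  L d * W d                                ∎

fibonacciLike-tail : ∀ {V : ℕ → ℕ} → (∀ j → 3 ≤ j → V j ≡ V (j ∸ 1) + V (j ∸ 2)) →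
  ∀ {n} → 0 < n → FibonacciLike (λ j → V (n + j))
fibonacciLike-tail Vrec {suc n} _ j rewrite +-suc n (suc j) | +-suc n j =
  Vrec (3 + (n + j)) (s≤s (s≤s (s≤s z≤n)))

Recurrence : ℕ → (ℕ → ℕ) → Set
Recurrence a Y = ∀ i → Y (2 + i) + Y i ≡ a * Y (1 + i)

recurrence-everyEven : ∀ {d} W → FibonacciLike W → 2 ∣ d → Recurrence (L d) (λ i → W (i * d))
recurrence-everyEven {d} W r 2∣d i =
  trans (cong (λ j → W j + W (i * d)) (sym (+-assoc d d (i * d))))
        (lucasIdentity-even (λ j → W (j + i * d)) (λ j → r (j + i * d)) 2∣d)

recurrence-unique : ∀ {a Y Z} → Recurrence a Y → Recurrence a Z →
  Y 0 ≡ Z 0 → Y 1 ≡ Z 1 → ∀ i → Y i ≡ Z i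
recurrence-unique {a} {Y} {Z} rY rZ Y₀ Y₁ i = proj₁ (agree i)
  where
    agree : ∀ i → Y i ≡ Z i × Y (1 + i) ≡ Z (1 + i)
    agree zero = Y₀ , Y₁
    agree (suc i) with agree i
    ... | Yᵢ , Yᵢ₊₁ = Yᵢ₊₁ , +-cancelʳ-≡ (Y i) _ _ (begin
      Y (2 + i) + Y i   ≡⟨ rY i ⟩
      a * Y (1 + i)     ≡⟨ cong (a *_) Yᵢ₊₁ ⟩
      a * Z (1 + i)     ≡⟨ sym (rZ i) ⟩
      Z (2 + i) + Z i   ≡⟨ cong (Z (2 + i) +_) (sym Yᵢ) ⟩
      Z (2 + i) + Y i   ∎)

recurrence-*ʳ : ∀ {a Y} → Recurrence a Y → ∀ c → Recurrence a (λ i → Y i * c)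
recurrence-*ʳ {a} {Y} rY c i = begin
  Y (2 + i) * c + Y i * c   ≡⟨ sym (*-distribʳ-+ c (Y (2 + i)) (Y i)) ⟩
  (Y (2 + i) + Y i) * c     ≡⟨ cong (_* c) (rY i) ⟩
  a * Y (1 + i) * c         ≡⟨ *-assoc a (Y (1 + i)) c ⟩
  a * (Y (1 + i) * c)       ∎

-- Summing Y_{i+1} − 2 Y_i + Y_{i-1} = t Y_i over 1 ≤ i ≤ k telescopes.
sum1-recurrence : ∀ {t Y} → Recurrence (2 + t) Y → ∀ k → t * sum1 k Y + Y k + Y 1 ≡ Y (suc k) + Y 0
sum1-recurrence {t} {Y} rY zero = lemma t (Y 0) (Y 1)
  where lemma : ∀ t a b → t * 0 + a + b ≡ b + a
        lemma = solve-∀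
sum1-recurrence {t} {Y} rY (suc k) = +-cancelʳ-≡ (Y k) _ _ (begin
    t * (S + Y (1 + k)) + Y (1 + k) + Y 1 + Y k   ≡⟨ regroupˡ t S (Y k) (Y (1 + k)) (Y 1) ⟩
    (t * S + Y k + Y 1) + (1 + t) * Y (1 + k)
      ≡⟨ cong (_+ (1 + t) * Y (1 + k)) (sum1-recurrence {t} {Y} rY k) ⟩
    (Y (1 + k) + Y 0) + (1 + t) * Y (1 + k)        ≡⟨ regroupʳ t (Y (1 + k)) (Y 0) ⟩
    (2 + t) * Y (1 + k) + Y 0                      ≡⟨ cong (_+ Y 0) (sym (rY k)) ⟩
    Y (2 + k) + Y k + Y 0                          ≡⟨ xy∙z≈xz∙y (Y (2 + k)) (Y k) (Y 0) ⟩
    Y (2 + k) + Y 0 + Y k                          ∎)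
  where
    S = sum1 k Y
    regroupˡ : ∀ t s a b c → t * (s + b) + b + c + a ≡ (t * s + a + c) + (1 + t) * b
    regroupˡ = solve-∀
    regroupʳ : ∀ t b z → (b + z) + (1 + t) * b ≡ (2 + t) * b + z
    regroupʳ = solve-∀

sum1-cong : ∀ k {f g} → (∀ i → 0 < i → i ≤ k → f i ≡ g i) → sum1 k f ≡ sum1 k g
sum1-cong zero f≡g = refl
sum1-cong (suc k) f≡g =
  cong₂ _+_ (sum1-cong k (λ i 0<i i≤k → f≡g i 0<i (m≤n⇒m≤1+n i≤k))) (f≡g (suc k) z<s ≤-refl)

sum1-*ˡ : ∀ k t f → sum1 k (λ i → t * f i) ≡ t * sum1 k f
sum1-*ˡ zero t f = sym (*-zeroʳ t)
sum1-*ˡ (suc k) t f =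
  trans (cong (_+ t * f (suc k)) (sum1-*ˡ k t f)) (sym (*-distribˡ-+ t (sum1 k f) (f (suc k))))

sum1-greedyDigits : ∀ {t Y} → Recurrence (2 + t) Y → ∀ k (μ : ℕ → ℕ) →
  (∀ i → 0 < i → i ≤ k → μ i ≡ t) → μ (suc k) ≡ suc t →
  sum1 (suc k) (λ i → μ i * Y i) + Y 1 ≡ Y (2 + k) + Y 0
sum1-greedyDigits {t} {Y} rY k μ μ≡t μ-last = begin
  sum1 k (λ i → μ i * Y i) + μ (suc k) * Y (suc k) + Y 1
    ≡⟨ cong₂ (λ s m → s + m * Y (suc k) + Y 1)
             (sum1-cong k (λ i 0<i i≤k → cong (_* Y i) (μ≡t i 0<i i≤k))) μ-last ⟩
  sum1 k (λ i → t * Y i) + suc t * Y (suc k) + Y 1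
    ≡⟨ cong (λ s → s + suc t * Y (suc k) + Y 1) (sum1-*ˡ k t Y) ⟩
  t * sum1 k Y + suc t * Y (suc k) + Y 1
    ≡⟨ cong (_+ Y 1) (regroup t (sum1 k Y) (Y (suc k))) ⟩
  t * sum1 (suc k) Y + Y (suc k) + Y 1
    ≡⟨ sum1-recurrence {t} {Y} rY (suc k) ⟩
  Y (2 + k) + Y 0 ∎
  where regroup : ∀ t s y → t * s + suc t * y ≡ t * (s + y) + y
        regroup = solve-∀

fdiv-quotient : ∀ q {b r} → r < b → fdiv (q * b + r) b ≡ q
fdiv-quotient q {suc b} {r} r<b = begin
  (q * suc b + r) / suc b          ≡⟨ +-distrib-/-∣ˡ r (n∣m*n q) ⟩
  q * suc b / suc b + r / suc b    ≡⟨ cong₂ _+_ (m*n/n≡m q (suc b)) (m<n⇒m/n≡0 r<b) ⟩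
  q + 0                            ≡⟨ +-identityʳ q ⟩
  q                                ∎

residual-cong : ∀ {c c′} → c ≗ c′ → ∀ k C m → residual c k C m ≡ residual c′ k C m
residual-cong c≗c′ k C zero = refl
residual-cong c≗c′ k C (suc m) =
  cong₂ (λ R b → R ∸ b * fdiv R b) (residual-cong c≗c′ k C m) (c≗c′ (k ∸ m))

Greedy-cong : ∀ {c c′} → c ≗ c′ → ∀ k C i → Greedy c k C i ≡ Greedy c′ k C i
Greedy-cong c≗c′ k C i = cong₂ fdiv (residual-cong c≗c′ k C (k ∸ i)) (c≗c′ i)

residual-start : ∀ c k C → residual c k C (k ∸ k) ≡ C
residual-start c k C = cong (residual c k C) (n∸n≡0 k)

greedy-digit : ∀ c k C i {q r} → suc i ≤ k → r < c (suc i) →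
  residual c k C (k ∸ suc i) ≡ q * c (suc i) + r →
  Greedy c k C (suc i) ≡ q × residual c k C (k ∸ i) ≡ r
greedy-digit c (suc k) C i {q} {r} (s≤s i≤k) r<cᵢ R≡ = digit , remainder
  where
    R = residual c (suc k) C (k ∸ i)
    digit : fdiv R (c (suc i)) ≡ q
    digit = trans (cong (λ x → fdiv x (c (suc i))) R≡) (fdiv-quotient q r<cᵢ)
    remainder : residual c (suc k) C (suc k ∸ i) ≡ r
    remainder = begin
      residual c (suc k) C (suc k ∸ i)
        ≡⟨ cong (residual c (suc k) C) (+-∸-assoc 1 i≤k) ⟩
      R ∸ c (suc k ∸ (k ∸ i)) * fdiv R (c (suc k ∸ (k ∸ i)))
        ≡⟨ cong (λ j → R ∸ c j * fdiv R (c j)) (m∸[m∸n]≡n (s≤s i≤k)) ⟩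
      R ∸ c (suc i) * fdiv R (c (suc i))
        ≡⟨ cong₂ (λ x y → x ∸ c (suc i) * y) R≡ digit ⟩
      (q * c (suc i) + r) ∸ c (suc i) * q
        ≡⟨ cong ((q * c (suc i) + r) ∸_) (*-comm (c (suc i)) q) ⟩
      (q * c (suc i) + r) ∸ q * c (suc i)
        ≡⟨ m+n∸m≡n (q * c (suc i)) r ⟩
      r ∎

monotone-bracket-unique : ∀ {f : ℕ → ℕ} → (∀ {i j} → i ≤ j → f i ≤ f j) →
  ∀ {x K K′} → f K ≤ x → x < f (suc K) → f K′ ≤ x → x < f (suc K′) → K ≡ K′
monotone-bracket-unique {f} mono {x} {K} {K′} fK≤x x<fK+1 fK′≤x x<fK′+1 =
  ≤-antisym (≮⇒≥ (λ K′<K → <⇒≱ x<fK′+1 (≤-trans (mono K′<K) fK≤x)))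
            (≮⇒≥ (λ K<K′ → <⇒≱ x<fK+1 (≤-trans (mono K<K′) fK′≤x)))

-- The solution of Recurrence (2 + t) from 0, 1, written through its differences
-- ΔG t j = G t (1 + j) − G t j so that no subtraction occurs.
mutual
  G : ℕ → ℕ → ℕ
  G t zero = 0
  G t (suc j) = G t j + ΔG t j

  ΔG : ℕ → ℕ → ℕ
  ΔG t zero = 1
  ΔG t (suc j) = t * (G t j + ΔG t j) + ΔG t j

G-recurrence : ∀ t → Recurrence (2 + t) (G t)
G-recurrence t i = lemma t (G t i) (ΔG t i)
  where lemma : ∀ t g δ → (g + δ) + (t * (g + δ) + δ) + g ≡ (2 + t) * (g + δ)
        lemma = solve-∀

ΔG-positive : ∀ t j → 0 < ΔG t j
ΔG-positive t zero = z<s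
ΔG-positive t (suc j) = ≤-trans (ΔG-positive t j) (m≤n+m (ΔG t j) _)

G-positive : ∀ t j → 0 < G t (suc j)
G-positive t j = ≤-trans (ΔG-positive t j) (m≤n+m (ΔG t j) (G t j))

G-<-suc : ∀ t j → G t j < G t (suc j)
G-<-suc t j = m<m+n (G t j) (ΔG-positive t j)

G-≤-+ : ∀ t m i → G t i ≤ G t (m + i)
G-≤-+ t zero i = ≤-refl
G-≤-+ t (suc m) i = ≤-trans (G-≤-+ t m i) (<⇒≤ (G-<-suc t (m + i)))

G-mono-≤ : ∀ t {i j} → i ≤ j → G t i ≤ G t j
G-mono-≤ t {i} {j} i≤j = subst (λ n → G t i ≤ G t n) (m∸n+n≡m i≤j) (G-≤-+ t (j ∸ i) i)

G-bracket-pred : ∀ t {k K} → G t K ≤ G t (suc k) ∸ 1 → G t (suc k) ∸ 1 < G t (suc K) → K ≡ k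
G-bracket-pred t {k} lo hi = monotone-bracket-unique (G-mono-≤ t) lo hi
  (suc[m]≤n⇒m≤pred[n] (G-<-suc t k)) (∸-monoʳ-< z<s (G-positive t k))

ΔG-∸-<-G : ∀ {t} ε {j} → 0 < j → ΔG t j ∸ ε < G t (suc j)
ΔG-∸-<-G {t} ε {suc j} _ = ≤-<-trans (m∸n≤m (ΔG t (suc j)) ε) (m<n+m (ΔG t (suc j)) (G-positive t j))

module _ {t ε : ℕ} (ε≤1 : ε ≤ 1) where

  G-∸-divmod : ∀ j → G t (2 + j) ∸ ε ≡ suc t * G t (suc j) + (ΔG t j ∸ ε)
  G-∸-divmod j = trans (cong (_∸ ε) (lemma t (G t j) (ΔG t j)))
                       (+-∸-assoc (suc t * G t (suc j)) (≤-trans ε≤1 (ΔG-positive t j)))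
    where lemma : ∀ t g δ → (g + δ) + (t * (g + δ) + δ) ≡ suc t * (g + δ) + δ
          lemma = solve-∀

  ΔG-∸-divmod : ∀ j → ΔG t (suc j) ∸ ε ≡ t * G t (suc j) + (ΔG t j ∸ ε)
  ΔG-∸-divmod j = +-∸-assoc (t * G t (suc j)) (≤-trans ε≤1 (ΔG-positive t j))

  residual-G : ∀ {k j} → 0 < j → suc j ≤‴ k →
    residual (G t) k (G t (suc k) ∸ ε) (k ∸ j) ≡ ΔG t j ∸ ε
  residual-G {k} {j} 0<j ≤‴-refl =
    proj₂ (greedy-digit (G t) k (G t (suc k) ∸ ε) j {q = suc t} ≤-refl (ΔG-∸-<-G ε 0<j)
                        (trans (residual-start (G t) k _) (G-∸-divmod j)))
  residual-G {k} {j} 0<j (≤‴-step j+1<k) =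
    proj₂ (greedy-digit (G t) k (G t (suc k) ∸ ε) j {q = t}
                        (<⇒≤ (≤″⇒≤ (≤‴⇒≤″ j+1<k))) (ΔG-∸-<-G ε 0<j)
                        (trans (residual-G z<s j+1<k) (ΔG-∸-divmod j)))

  greedy-G-last : ∀ {k} → 0 < k → Greedy (G t) (suc k) (G t (2 + k) ∸ ε) (suc k) ≡ suc t
  greedy-G-last {k} 0<k =
    proj₁ (greedy-digit (G t) (suc k) (G t (2 + k) ∸ ε) k {q = suc t} ≤-refl (ΔG-∸-<-G ε 0<k)
                        (trans (residual-start (G t) (suc k) _) (G-∸-divmod k)))

  greedy-G-middle : ∀ {k i} → 0 < i → suc i ≤ k → Greedy (G t) (suc k) (G t (2 + k) ∸ ε) (suc i) ≡ t
  greedy-G-middle {k} {i} 0<i i<k =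
    proj₁ (greedy-digit (G t) (suc k) (G t (2 + k) ∸ ε) i {q = t} (m≤n⇒m≤1+n i<k) (ΔG-∸-<-G ε 0<i)
                        (trans (residual-G z<s (≤⇒≤‴ (s≤s i<k))) (ΔG-∸-divmod i)))

  greedy-G-first : ∀ {k} → 0 < k → Greedy (G t) (suc k) (G t (2 + k) ∸ ε) 1 ≡ suc t ∸ ε
  greedy-G-first {k} 0<k = begin
    residual (G t) (suc k) (G t (2 + k) ∸ ε) k / 1    ≡⟨ n/1≡n _ ⟩
    residual (G t) (suc k) (G t (2 + k) ∸ ε) k        ≡⟨ residual-G z<s (≤⇒≤‴ (s≤s 0<k)) ⟩
    ΔG t 1 ∸ ε                                        ≡⟨ cong (λ x → x + 1 ∸ ε) (*-identityʳ t) ⟩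
    t + 1 ∸ ε                                         ≡⟨ cong (_∸ ε) (+-comm t 1) ⟩
    suc t ∸ ε                                         ∎

L-positive : ∀ j → 0 < L j
L-positive zero = z<s
L-positive (suc zero) = z<s
L-positive (suc (suc j)) = ≤-trans (L-positive (suc j)) (m≤m+n (L (suc j)) (L j))

F-positive : ∀ {j} → 0 < j → 0 < F j
F-positive {suc zero} _ = z<s
F-positive {suc (suc j)} _ = ≤-trans (F-positive {suc j} z<s) (m≤m+n (F (suc j)) (F j))

L-even-≥2 : ∀ {d} → 2 ∣ d → 0 < d → 2 ≤ L d
L-even-≥2 (divides (suc q) refl) _ = +-mono-≤ (L-positive (suc (q * 2))) (L-positive (q * 2))

module EvenCoefficients {d : ℕ} (2∣d : 2 ∣ d) (0<d : 0 < d) where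

  t : ℕ
  t = L d ∸ 2

  L≡2+t : L d ≡ 2 + t
  L≡2+t = sym (m+[n∸m]≡n (L-even-≥2 2∣d 0<d))

  recurrence-multiples : ∀ W → FibonacciLike W → Recurrence (2 + t) (λ i → W (i * d))
  recurrence-multiples W r =
    subst (λ a → Recurrence a (λ i → W (i * d))) L≡2+t (recurrence-everyEven W r 2∣d)

  F-multiple : ∀ i → F (i * d) ≡ G t i * F d
  F-multiple = recurrence-unique {a = 2 + t} {Y = λ i → F (i * d)} {Z = λ i → G t i * F d}
    (recurrence-multiples F (λ _ → refl)) (recurrence-*ʳ {a = 2 + t} {Y = G t} (G-recurrence t) (F d))
    refl (trans (cong F (+-identityʳ d)) (sym (*-identityˡ (F d))))

  coef≗G : coef d ≗ G t
  coef≗G i = trans (cong (λ x → fdiv x (F d)) (trans (F-multiple i) (sym (+-identityʳ _))))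
                   (fdiv-quotient (G t i) (F-positive 0<d))

  greedy-coef≡G : ∀ k ε i →
    Greedy (coef d) k (coef d (suc k) ∸ ε) i ≡ Greedy (G t) k (G t (suc k) ∸ ε) i
  greedy-coef≡G k ε i =
    trans (Greedy-cong coef≗G k _ i) (cong (λ C → Greedy (G t) k (C ∸ ε) i) (coef≗G (suc k)))

  coef-bracket-pred : ∀ {k K} →
    coef d K ≤ coef d (suc k) ∸ 1 → coef d (suc k) ∸ 1 < coef d (suc K) → K ≡ k
  coef-bracket-pred {k} {K} lo hi = G-bracket-pred t
    (subst₂ _≤_ (coef≗G K) (cong (_∸ 1) (coef≗G (suc k))) lo)
    (subst₂ _<_ (cong (_∸ 1) (coef≗G (suc k))) (coef≗G (suc K)) hi)

  greedyDigit : ℕ → ℕ → ℕ → ℕ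
  greedyDigit k ε = Greedy (coef d) (suc k) (coef d (2 + k) ∸ ε)

  greedyDigit-first : ∀ {k ε} → ε ≤ 1 → 0 < k → greedyDigit k ε 1 ≡ suc t ∸ ε
  greedyDigit-first {k} {ε} ε≤1 0<k = trans (greedy-coef≡G (suc k) ε 1) (greedy-G-first ε≤1 0<k)

  greedyDigit-middle : ∀ {k ε i} → ε ≤ 1 → 0 < i → suc i ≤ k → greedyDigit k ε (suc i) ≡ t
  greedyDigit-middle {k} {ε} {i} ε≤1 0<i i<k =
    trans (greedy-coef≡G (suc k) ε (suc i)) (greedy-G-middle ε≤1 0<i i<k)

  greedyDigit-last : ∀ {k ε} → ε ≤ 1 → 0 < k → greedyDigit k ε (suc k) ≡ suc t
  greedyDigit-last {k} {ε} ε≤1 0<k = trans (greedy-coef≡G (suc k) ε (suc k)) (greedy-G-last ε≤1 0<k)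

  greedyDigit-pred-below-last : ∀ {k} → 0 < k → ∀ i → 0 < i → i ≤ k → greedyDigit k 1 i ≡ t
  greedyDigit-pred-below-last 0<k (suc zero) _ _ = greedyDigit-first ≤-refl 0<k
  greedyDigit-pred-below-last 0<k (suc (suc i)) _ i<k = greedyDigit-middle ≤-refl z<s i<k

  sK-coef-pred : ∀ V n {k} → FibonacciLike (λ j → V (n + j)) → 0 < k →
    ∀ K → coef d K ≤ coef d (2 + k) ∸ 1 → coef d (2 + k) ∸ 1 < coef d (suc K) →
    sK V n d K (coef d (2 + k) ∸ 1) + V (n + d) ≡ V (n + (2 + k) * d) + V n
  sK-coef-pred V n {k} fibV 0<k K lo hi with coef-bracket-pred {suc k} {K} lo hi
  ... | refl = begin
    sK V n d (suc k) C + V (n + d)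
      ≡⟨ cong (λ j → sK V n d (suc k) C + V (n + j)) (sym (*-identityˡ d)) ⟩
    sum1 (suc k) (λ i → greedyDigit k 1 i * Y i) + Y 1
      ≡⟨ sum1-greedyDigits (recurrence-multiples (λ j → V (n + j)) fibV) k (greedyDigit k 1)
                           (greedyDigit-pred-below-last 0<k) (greedyDigit-last ≤-refl 0<k) ⟩
    Y (2 + k) + Y 0
      ≡⟨ cong (λ j → Y (2 + k) + V j) (+-identityʳ n) ⟩
    Y (2 + k) + V n ∎
    where
      C = coef d (2 + k) ∸ 1
      Y : ℕ → ℕ
      Y i = V (n + i * d)

proposition3p2p4 : (V : ℕ → ℕ) → (∀ j → 1 ≤ j → 0 < V j)
    → (∀ j → 3 ≤ j → V j ≡ V (j ∸ 1) + V (j ∸ 2))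
    → (n d k : ℕ) → 1 ≤ n → 2 ≤ d → 2 ∣ d → 1 < k
    → let lam = Greedy (coef d) k (coef d (suc k))
          lam′ = Greedy (coef d) k (coef d (suc k) ∸ 1)
      in (lam 1 ≡ L d ∸ 1 × lam k ≡ L d ∸ 1
          × (∀ i → 2 ≤ i → i ≤ k ∸ 1 → lam i ≡ L d ∸ 2))
       × (lam′ 1 ≡ lam 1 ∸ 1 × (∀ i → 2 ≤ i → i ≤ k → lam′ i ≡ lam i))
       × (∀ K → 1 ≤ K → coef d K ≤ coef d (suc k) ∸ 1
            → coef d (suc k) ∸ 1 < coef d (suc K)
            → sK V n d K (coef d (suc k) ∸ 1) + V (n + d)
              ≡ V (n + suc k * d) + V n)
proposition3p2p4 V _ Vrec n d (suc k) 0<n 2≤d 2∣d (s≤s 0<k) =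
    ( trans (greedyDigit-first z≤n 0<k) L∸1
    , trans (greedyDigit-last z≤n 0<k) L∸1
    , λ { (suc i) (s≤s 0<i) i<k → greedyDigit-middle z≤n 0<i i<k } )
  , ( trans (greedyDigit-first ≤-refl 0<k) (cong (_∸ 1) (sym (greedyDigit-first z≤n 0<k)))
    , digits-agree )
  , λ K _ → sK-coef-pred V n (fibonacciLike-tail Vrec 0<n) 0<k K
  where
    open EvenCoefficients 2∣d (≤-trans (s≤s z≤n) 2≤d)

    L∸1 : suc t ≡ L d ∸ 1
    L∸1 = cong (_∸ 1) (sym L≡2+t)

    digits-agree : ∀ i → 2 ≤ i → i ≤ suc k → greedyDigit k 1 i ≡ greedyDigit k 0 i
    digits-agree (suc i) (s≤s 0<i) i≤k with m≤n⇒m<n∨m≡n i≤k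
    ... | inj₁ (s≤s i<k) = trans (greedyDigit-middle ≤-refl 0<i i<k) (sym (greedyDigit-middle z≤n 0<i i<k))
    ... | inj₂ refl      = trans (greedyDigit-last ≤-refl 0<k) (sym (greedyDigit-last z≤n 0<k))
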